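{- Let $c_1,c_2,\dots$ be indeterminates over $\mathbb{Q}$ and let $n$ be a positive integer. If $s$ is a positive integer, then $$\left(s^n-1\right)\sum_{\substack{p\text{ prime},\ p-1\mid n\\ p\nmid s}}\frac{c_{p-1}^{\,n/(p-1)}}{p}\in\mathbb{Z}[c_1,c_2,\dots].$$ -}

module Defs where

open import Data.Bool using (Bool; true; false; _∧_; not; if_then_else_)
open import Data.Nat as ℕ using (ℕ; zero; suc; _^_; _≡ᵇ_)
open import Data.Nat.DivMod using (_/_)
open import Data.Nat.Divisibility using (_∣?_)
open import Data.Nat.Primality using (prime?)
open import Data.Integer as ℤ using (ℤ; +_)
open import Data.Rational as ℚ using (ℚ; 0ℚ)
open import Data.List using (List; []; _∷_; _++_; replicate; concatMap; upTo; [_])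
open import Data.Product using (_×_; _,_)
open import Relation.Nullary.Decidable using (⌊_⌋)
open import Relation.Binary.PropositionalEquality using (_≡_)

-- A monomial in the indeterminates c₁, c₂, … is its exponent list
-- [e₁, e₂, …]; lists differing only by trailing zeros denote the same monomial.
Monomial : Set
Monomial = List ℕ

sameMon : Monomial → Monomial → Bool
sameMon []       []       = true
sameMon []       (y ∷ ys) = (y ≡ᵇ 0) ∧ sameMon [] ys
sameMon (x ∷ xs) []       = (x ≡ᵇ 0) ∧ sameMon xs []
sameMon (x ∷ xs) (y ∷ ys) = (x ≡ᵇ y) ∧ sameMon xs ys

-- An element of ℚ[c₁, c₂, …], given as a finite formal sum of terms q·m.
Poly : Set
Poly = List (ℚ × Monomial)

coeff : Poly → Monomial → ℚ
coeff []            m = 0ℚ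
coeff ((q , m') ∷ P) m = if sameMon m' m then q ℚ.+ coeff P m else coeff P m

scale : ℚ → Poly → Poly
scale a []            = []
scale a ((q , m) ∷ P) = (a ℚ.* q , m) ∷ scale a P

InZc : Poly → Set
InZc P = ∀ (m : Monomial) → ℚ.denominatorℕ (coeff P m) ≡ 1

-- the monomial c_{k+1}^e
cPow : ℕ → ℕ → Monomial
cPow k e = replicate k 0 ++ [ e ]

-- Σ over primes p with (p-1) ∣ n and p ∤ s of c_{p-1}^{n/(p-1)} / p.
-- For n ≥ 1, (p-1) ∣ n forces p - 1 ≤ n, so writing p = k + 2 with
-- k ∈ {0, …, n-1} enumerates all candidates.
primeSum : ℕ → ℕ → Poly
primeSum n s = concatMap term (upTo n)
  where
  term : ℕ → Poly
  term k = if ⌊ prime? (suc (suc k)) ⌋ ∧ ⌊ suc k ∣? n ⌋ ∧ not ⌊ suc (suc k) ∣? s ⌋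
           then [ ((+ 1) ℚ./ suc (suc k) , cPow k (n / suc k)) ]
           else []

sPowMinusOne : ℕ → ℕ → ℚ
sPowMinusOne s n = (+ (s ^ n) ℤ.- + 1) ℚ./ 1

-- Each summand is (s^n - 1)/p · c_{p-1}^{n/(p-1)} for a prime p ∤ s with p - 1 ∣ n, and
-- s^n = (s^(p-1))^(n/(p-1)) ≡ 1 (mod p) by Fermat's little theorem, so it has an integer
-- coefficient; every coefficient of the scaled sum is a sum of these. Fermat's theorem itself
-- follows by induction on a from (a + 1)^p ≡ a^p + 1 (mod p), since p divides p C k for 0 < k < p.

{-# OPTIONS --safe #-}
module Submission where

open import Defs
open import Data.Bool using (true; false; _∧_; not; if_then_else_)
open import Data.Fin.Base using (zero; suc; toℕ; fromℕ; inject₁)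
open import Data.Fin.Properties using (toℕ-fromℕ; toℕ-inject₁; toℕ<n)
import Data.Integer as ℤ
import Data.Integer.Properties as ℤ
open import Data.List using ([]; _∷_; [_]; upTo)
open import Data.List.Relation.Unary.All using (All; []; _∷_; universal)
open import Data.List.Relation.Unary.All.Properties using (concat⁺; map⁺)
open import Data.Nat using (ℕ; _≤_)
open import Data.Nat.Base using (+-0-rawMonoid; zero; suc; _+_; _*_; _∸_; _^_; _<_; z<s; s<s)
open import Data.Nat.Combinatorics using (_C_; nCn≡1; nC1≡n; nCk+nC[k+1]≡[n+1]C[k+1])
open import Data.Nat.Coprimality using (coprime?)
open import Data.Nat.Divisibility
  using (_∣_; _∤_; divides; _∣0; ∣-refl; ∣⇒≤; ∣m∣n⇒∣m+n; ∣m⇒∣m*n; _∣?_)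
open import Data.Nat.DivMod using (_/_)
open import Data.Nat.Primality using (Prime; prime?; euclidsLemma)
open import Data.Nat.Properties
open import Data.Nat.Tactic.RingSolver using (solve-∀)
open import Data.Product using (∃-syntax; _×_; _,_; proj₁; proj₂)
open import Data.Rational as ℚ using (ℚ; mkℚ; toℚᵘ)
open import Data.Rational.Properties using (toℚᵘ-homo-+; toℚᵘ-homo-*; toℚᵘ-fromℚᵘ)
open import Data.Rational.Unnormalised as ℚᵘ using (mkℚᵘ; *≡*) renaming (_≃_ to _≃ᵘ_)
import Data.Rational.Unnormalised.Properties as ℚᵘ
open import Data.Sum using (inj₁; inj₂; fromInj₂)
open import Data.Vec.Functional using (Vector; init; tail)
open import Function using (_∘_)
open import Relation.Nullary using (contradiction)
open import Relation.Nullary.Decidable using (⌊_⌋; yes; no; recompute)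
open import Relation.Binary.PropositionalEquality
  using (_≡_; refl; sym; trans; cong; cong₂; subst; module ≡-Reasoning)

open import Algebra.Properties.CommutativeSemiring.Binomial +-*-commutativeSemiring as Binomial
  using (binomialTerm)
open import Algebra.Properties.Monoid.Sum +-0-monoid using (sum; sum-init-last)
import Algebra.Properties.Semiring.Exp +-*-semiring as Semiring
import Algebra.Definitions.RawMonoid +-0-rawMonoid as Monoid

open _∣_ using (quotient; equality)

×≡* : ∀ n x → n Monoid.× x ≡ n * x
×≡* zero    x = refl
×≡* (suc n) x = cong (x +_) (×≡* n x)

^≡^ : ∀ x n → x Semiring.^ n ≡ x ^ n
^≡^ x zero    = refl
^≡^ x (suc n) = cong (x *_) (^≡^ x n)

∣-sum : ∀ {d n} (f : Vector ℕ n) → (∀ i → d ∣ f i) → d ∣ sum f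
∣-sum {n = zero}  f d∣f = _ ∣0
∣-sum {n = suc n} f d∣f = ∣m∣n⇒∣m+n (d∣f zero) (∣-sum (tail f) (d∣f ∘ suc))

[1+k]*[1+n]C[1+k]≡[1+n]*nCk : ∀ n k → suc k * (suc n C suc k) ≡ suc n * (n C k)
[1+k]*[1+n]C[1+k]≡[1+n]*nCk zero    zero    = refl
[1+k]*[1+n]C[1+k]≡[1+n]*nCk zero    (suc k) = *-zeroʳ (2 + k)
[1+k]*[1+n]C[1+k]≡[1+n]*nCk (suc n) zero    =
  trans (+-identityʳ _) (trans (nC1≡n (2 + n)) (sym (*-identityʳ (2 + n))))
[1+k]*[1+n]C[1+k]≡[1+n]*nCk (suc n) (suc k) = begin
  (2 + k) * ((2 + n) C (2 + k))                    ≡⟨ cong ((2 + k) *_) (nCk+nC[k+1]≡[n+1]C[k+1] (suc n) (suc k)) ⟨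
  (2 + k) * (X + (1 + n) C (2 + k))                ≡⟨ spread (suc k) X ((1 + n) C (2 + k)) ⟩
  X + (1 + k) * X + (2 + k) * ((1 + n) C (2 + k))
    ≡⟨ cong₂ (λ u v → X + u + v) ([1+k]*[1+n]C[1+k]≡[1+n]*nCk n k) ([1+k]*[1+n]C[1+k]≡[1+n]*nCk n (suc k)) ⟩
  X + (1 + n) * (n C k) + (1 + n) * (n C (1 + k))  ≡⟨ collect X (suc n) (n C k) (n C (1 + k)) ⟩
  X + (1 + n) * (n C k + n C (1 + k))              ≡⟨ cong (λ u → X + (1 + n) * u) (nCk+nC[k+1]≡[n+1]C[k+1] n k) ⟩
  (2 + n) * X                                      ∎
  where
  open ≡-Reasoning
  X = (1 + n) C (1 + k)
  spread : ∀ k X Y → suc k * (X + Y) ≡ X + k * X + suc k * Y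
  spread = solve-∀
  collect : ∀ X m a b → X + m * a + m * b ≡ X + m * (a + b)
  collect = solve-∀

prime∣pCk : ∀ {p k} → Prime p → 0 < k → k < p → p ∣ p C k
prime∣pCk {suc p} {suc k} pp _ k<p
  with euclidsLemma (suc k) (suc p C suc k) pp
         (divides (p C k) (trans ([1+k]*[1+n]C[1+k]≡[1+n]*nCk p k) (*-comm (suc p) (p C k))))
... | inj₁ p∣k   = contradiction (∣⇒≤ p∣k) (<⇒≱ k<p)
... | inj₂ p∣pCk = p∣pCk

binomialTerm[a,1]≡nCk*a^k : ∀ a n i → binomialTerm a 1 n i ≡ (n C toℕ i) * a ^ toℕ i
binomialTerm[a,1]≡nCk*a^k a n i = begin
  (n C k) Monoid.× (a Semiring.^ k * 1 Semiring.^ (n ∸ k)) ≡⟨ ×≡* (n C k) _ ⟩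
  (n C k) * (a Semiring.^ k * 1 Semiring.^ (n ∸ k))
    ≡⟨ cong₂ (λ u v → (n C k) * (u * v)) (^≡^ a k) (trans (^≡^ 1 (n ∸ k)) (^-zeroˡ (n ∸ k))) ⟩
  (n C k) * (a ^ k * 1)                                     ≡⟨ cong ((n C k) *_) (*-identityʳ (a ^ k)) ⟩
  (n C k) * a ^ k                                           ∎
  where
  open ≡-Reasoning
  k = toℕ i

prime∣binomialMiddle : ∀ {p} → Prime (suc p) → ∀ a → suc p ∣ sum (init (tail (binomialTerm a 1 (suc p))))
prime∣binomialMiddle {p} pp a = ∣-sum _ λ i →
  subst (suc p ∣_) (sym (binomialTerm[a,1]≡nCk*a^k a (suc p) (suc (inject₁ i))))
    (∣m⇒∣m*n _ (prime∣pCk pp z<s (s<s (subst (_< p) (sym (toℕ-inject₁ i)) (toℕ<n i)))))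

[1+a]^p≡1+a^p-mod-p : ∀ {p} → Prime p → ∀ a → ∃[ t ] suc a ^ p ≡ 1 + a ^ p + p * t
[1+a]^p≡1+a^p-mod-p {suc p} pp a with prime∣binomialMiddle pp a
... | divides t middle≡t*p = t , (begin
  suc a ^ suc p                                  ≡⟨ cong (_^ suc p) (+-comm 1 a) ⟩
  (a + 1) ^ suc p                                ≡⟨ ^≡^ (a + 1) (suc p) ⟨
  (a + 1) Semiring.^ suc p                       ≡⟨ Binomial.theorem (suc p) a 1 ⟩
  f zero + sum (tail f)                          ≡⟨ cong (f zero +_) (sum-init-last (tail f)) ⟩
  f zero + (sum (init (tail f)) + f (fromℕ (suc p)))
    ≡⟨ cong₂ (λ u v → u + (v + f (fromℕ (suc p)))) (binomialTerm[a,1]≡nCk*a^k a (suc p) zero) middle≡t*p ⟩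
  1 + (t * suc p + f (fromℕ (suc p)))            ≡⟨ cong (λ u → 1 + (t * suc p + u)) lastTerm ⟩
  1 + (t * suc p + a ^ suc p)                    ≡⟨ rearrange t (suc p) (a ^ suc p) ⟩
  1 + a ^ suc p + suc p * t                      ∎)
  where
  open ≡-Reasoning
  f = binomialTerm a 1 (suc p)
  lastTerm : f (fromℕ (suc p)) ≡ a ^ suc p
  lastTerm = begin
    f (fromℕ (suc p))                       ≡⟨ binomialTerm[a,1]≡nCk*a^k a (suc p) (fromℕ (suc p)) ⟩
    (suc p C toℕ (fromℕ (suc p))) * a ^ toℕ (fromℕ (suc p)) ≡⟨ cong (λ k → (suc p C k) * a ^ k) (toℕ-fromℕ (suc p)) ⟩
    (suc p C suc p) * a ^ suc p             ≡⟨ cong (_* a ^ suc p) (nCn≡1 (suc p)) ⟩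
    1 * a ^ suc p                           ≡⟨ *-identityˡ (a ^ suc p) ⟩
    a ^ suc p                               ∎
  rearrange : ∀ t p x → 1 + (t * p + x) ≡ 1 + x + p * t
  rearrange = solve-∀

-- Results are taken apart by projections: abstracting over them with `with` makes
-- type checking unfold the binomial expansion and become very slow.
fermat : ∀ {p} → Prime p → ∀ a → ∃[ t ] a ^ p ≡ a + p * t
fermat {suc p} pp zero    = 0 , sym (*-zeroʳ (suc p))
fermat {suc p} pp (suc a) = t + u , (begin
  suc a ^ suc p                      ≡⟨ [1+a]^p≡ ⟩
  1 + a ^ suc p + suc p * t          ≡⟨ cong (λ x → 1 + x + suc p * t) a^p≡ ⟩
  1 + (a + suc p * u) + suc p * t    ≡⟨ regroup a (suc p) t u ⟩
  suc a + suc p * (t + u)            ∎)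
  where
  open ≡-Reasoning
  t = proj₁ ([1+a]^p≡1+a^p-mod-p pp a)
  [1+a]^p≡ = proj₂ ([1+a]^p≡1+a^p-mod-p pp a)
  u = proj₁ (fermat pp a)
  a^p≡ = proj₂ (fermat pp a)
  regroup : ∀ a p t u → 1 + (a + p * u) + p * t ≡ suc a + p * (t + u)
  regroup = solve-∀

prime∣s^p∸1 : ∀ {p s} → Prime (suc p) → suc p ∤ s → suc p ∣ s ^ p ∸ 1
prime∣s^p∸1 {p} {s} pp p∤s =
  fromInj₂ (λ p∣s → contradiction p∣s p∤s) (euclidsLemma s (s ^ p ∸ 1) pp (divides t s*[s^p∸1]≡t*p))
  where
  open ≡-Reasoning
  t = proj₁ (fermat pp s)
  s*[s^p∸1]≡t*p : s * (s ^ p ∸ 1) ≡ t * suc p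
  s*[s^p∸1]≡t*p = begin
    s * (s ^ p ∸ 1)          ≡⟨ *-distribˡ-∸ s (s ^ p) 1 ⟩
    s ^ suc p ∸ s * 1        ≡⟨ cong₂ _∸_ (proj₂ (fermat pp s)) (*-identityʳ s) ⟩
    s + suc p * t ∸ s        ≡⟨ m+n∸m≡n s (suc p * t) ⟩
    suc p * t                ≡⟨ *-comm (suc p) t ⟩
    t * suc p                ∎

fermat-coprime : ∀ {p s} → Prime (suc p) → suc p ∤ s → ∃[ u ] s ^ p ≡ 1 + suc p * u
fermat-coprime {p} {zero}  pp p∤s = contradiction (suc p ∣0) p∤s
fermat-coprime {p} {suc s} pp p∤s = quotient p∣s^p∸1 , (begin
  suc s ^ p                      ≡⟨ m+[n∸m]≡n (m^n>0 (suc s) p) ⟨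
  1 + (suc s ^ p ∸ 1)            ≡⟨ cong (1 +_) (equality p∣s^p∸1) ⟩
  1 + quotient p∣s^p∸1 * suc p   ≡⟨ cong (1 +_) (*-comm (quotient p∣s^p∸1) (suc p)) ⟩
  1 + suc p * quotient p∣s^p∸1   ∎)
  where
  open ≡-Reasoning
  p∣s^p∸1 = prime∣s^p∸1 pp p∤s

^-pres-≡1-mod : ∀ p {x u} → x ≡ 1 + p * u → ∀ m → ∃[ v ] x ^ m ≡ 1 + p * v
^-pres-≡1-mod p x≡ zero    = 0 , cong suc (sym (*-zeroʳ p))
^-pres-≡1-mod p {x} {u} x≡ (suc m) = u + v + p * u * v , (begin
  x * x ^ m                    ≡⟨ cong₂ _*_ x≡ x^m≡ ⟩
  (1 + p * u) * (1 + p * v)    ≡⟨ expand p u v ⟩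
  1 + p * (u + v + p * u * v)  ∎)
  where
  open ≡-Reasoning
  v = proj₁ (^-pres-≡1-mod p x≡ m)
  x^m≡ = proj₂ (^-pres-≡1-mod p x≡ m)
  expand : ∀ p u v → (1 + p * u) * (1 + p * v) ≡ 1 + p * (u + v + p * u * v)
  expand = solve-∀

[p-1]∣n⇒s^n≡1-mod-p : ∀ {p n s} → Prime (suc p) → p ∣ n → suc p ∤ s → ∃[ v ] s ^ n ≡ 1 + suc p * v
[p-1]∣n⇒s^n≡1-mod-p {p} {n} {s} pp (divides q n≡q*p) p∤s = proj₁ [s^p]^q≡ , (begin
  s ^ n          ≡⟨ cong (s ^_) (trans n≡q*p (*-comm q p)) ⟩
  s ^ (p * q)    ≡⟨ ^-*-assoc s p q ⟨
  (s ^ p) ^ q    ≡⟨ proj₂ [s^p]^q≡ ⟩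
  1 + suc p * proj₁ [s^p]^q≡ ∎)
  where
  open ≡-Reasoning
  [s^p]^q≡ = ^-pres-≡1-mod (suc p) (proj₂ (fermat-coprime pp p∤s)) q

Integral : ℚ → Set
Integral q = ∃[ z ] toℚᵘ q ≃ᵘ mkℚᵘ z 0

integral-0 : Integral ℚ.0ℚ
integral-0 = ℤ.+ 0 , ℚᵘ.≃-refl

integral-+ : ∀ {q r} → Integral q → Integral r → Integral (q ℚ.+ r)
integral-+ {q} {r} (z , q≃z) (w , r≃w) = z ℤ.+ w ,
  ℚᵘ.≃-trans (toℚᵘ-homo-+ q r) (ℚᵘ.≃-trans (ℚᵘ.+-cong q≃z r≃w) (*≡* (cross-multiplied z w)))
  where
  cross-multiplied : ∀ z w → (z ℤ.* ℤ.+ 1 ℤ.+ w ℤ.* ℤ.+ 1) ℤ.* ℤ.+ 1 ≡ (z ℤ.+ w) ℤ.* ℤ.+ 1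
  cross-multiplied z w rewrite ℤ.*-identityʳ z | ℤ.*-identityʳ w | ℤ.*-identityʳ (z ℤ.+ w) = refl

integral⇒denominator≡1 : ∀ {q} → Integral q → ℚ.denominatorℕ q ≡ 1
integral⇒denominator≡1 {mkℚ num d coprime} (z , *≡* num*1≡z*d) =
  recompute (coprime? _ _) coprime (d∣num , ∣-refl)
  where
  d∣num : suc d ∣ ℤ.∣ num ∣
  d∣num = divides ℤ.∣ z ∣
    (trans (cong ℤ.∣_∣ (trans (sym (ℤ.*-identityʳ num)) num*1≡z*d)) (ℤ.abs-* z (ℤ.+ suc d)))

integral-[p*v]/p : ∀ p v → Integral ((ℤ.+ (suc p * v) ℚ./ 1) ℚ.* (ℤ.+ 1 ℚ./ suc p))
integral-[p*v]/p p v = ℤ.+ v ,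
  ℚᵘ.≃-trans (toℚᵘ-homo-* (ℤ.+ (suc p * v) ℚ./ 1) (ℤ.+ 1 ℚ./ suc p))
    (ℚᵘ.≃-trans (ℚᵘ.*-cong (toℚᵘ-fromℚᵘ (mkℚᵘ (ℤ.+ (suc p * v)) 0)) (toℚᵘ-fromℚᵘ (mkℚᵘ (ℤ.+ 1) p)))
      (*≡* cross-multiplied))
  where
  cross-multiplied : (ℤ.+ (suc p * v) ℤ.* ℤ.+ 1) ℤ.* ℤ.+ 1 ≡ ℤ.+ v ℤ.* ℤ.+ (1 * suc p)
  cross-multiplied = begin
    (ℤ.+ (suc p * v) ℤ.* ℤ.+ 1) ℤ.* ℤ.+ 1 ≡⟨ trans (ℤ.*-identityʳ _) (ℤ.*-identityʳ _) ⟩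
    ℤ.+ (suc p * v)                      ≡⟨ cong ℤ.+_ (trans (*-comm (suc p) v) (cong (v *_) (sym (*-identityˡ (suc p))))) ⟩
    ℤ.+ (v * (1 * suc p))                ≡⟨ ℤ.pos-* v (1 * suc p) ⟩
    ℤ.+ v ℤ.* ℤ.+ (1 * suc p)            ∎
    where open ≡-Reasoning

IntegralTerm : ℚ → ℚ × Monomial → Set
IntegralTerm a (q , _) = Integral (a ℚ.* q)

coeff-scale-integral : ∀ a {P} → All (IntegralTerm a) P → ∀ m → Integral (coeff (scale a P) m)
coeff-scale-integral a []                         m = integral-0
coeff-scale-integral a {(_ , m′) ∷ _} (aq ∷ aP) m with sameMon m′ m
... | true  = integral-+ aq (coeff-scale-integral a aP m)
... | false = coeff-scale-integral a aP m

summand-integral : ∀ {n s k} → Prime (suc (suc k)) → suc k ∣ n → suc (suc k) ∤ s →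
                   Integral (sPowMinusOne s n ℚ.* (ℤ.+ 1 ℚ./ suc (suc k)))
summand-integral {n} {s} {k} pp k+1∣n p∤s =
  -- ℤ.+ (1 + m) ℤ.- ℤ.+ 1 reduces to ℤ.+ m
  subst (λ x → Integral (((ℤ.+ x ℤ.- ℤ.+ 1) ℚ./ 1) ℚ.* (ℤ.+ 1 ℚ./ suc (suc k))))
    (sym (proj₂ s^n≡)) (integral-[p*v]/p (suc k) (proj₁ s^n≡))
  where
  s^n≡ = [p-1]∣n⇒s^n≡1-mod-p pp k+1∣n p∤s

primeSum-integral : ∀ n s → All (IntegralTerm (sPowMinusOne s n)) (primeSum n s)
primeSum-integral n s = concat⁺ (map⁺ (universal summand (upTo n)))
  where
  summand : ∀ k → All (IntegralTerm (sPowMinusOne s n))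
    (if ⌊ prime? (suc (suc k)) ⌋ ∧ ⌊ suc k ∣? n ⌋ ∧ not ⌊ suc (suc k) ∣? s ⌋
     then [ (ℤ.+ 1 ℚ./ suc (suc k) , cPow k (n / suc k)) ]
     else [])
  summand k with prime? (suc (suc k)) | suc k ∣? n | suc (suc k) ∣? s
  ... | yes pp | yes k+1∣n | no p∤s = summand-integral pp k+1∣n p∤s ∷ []
  ... | yes _  | yes _     | yes _  = []
  ... | yes _  | no _      | _      = []
  ... | no _   | _         | _      = []

lemma2 : (n s : ℕ) → 1 ≤ n → 1 ≤ s → InZc (scale (sPowMinusOne s n) (primeSum n s))
lemma2 n s _ _ m =
  integral⇒denominator≡1 (coeff-scale-integral (sPowMinusOne s n) (primeSum-integral n s) m)
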